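{- Let $G$ be an abelian group and let $X$ be a pyramidal set of $G$ with $H_0<H_1<\cdots<H_{2t-1} \le H_{2t} = G$ as an associated admissible subgroup series. Then: (a) if $H_0=\{0\}$ and $X$ is aperiodic, then for each $0 \le i \le t-1$, $X/H_{2i}$ is a pyramidal set of $G/H_{2i}$ with $H_{2i}/H_{2i}<H_{2i+1}/H_{2i}<\cdots<H_{2t-1}/H_{2i} \le H_{2t}/H_{2i} = G/H_{2i}$ as an associated admissible subgroup series; (b) if $H_0\neq\{0\}$ and $X$ is $H_0$-periodic, then for each $0 \le i \le t-2$, $X/H_{2i+1}$ is a pyramidal set of $G/H_{2i+1}$ with $H_{2i+2}/H_{2i+1}<H_{2i+3}/H_{2i+1}<\cdots<H_{2t-1}/H_{2i+1} \le H_{2t}/H_{2i+1} = G/H_{2i+1}$ as an associated admissible subgroup series.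
   Context: Groups are additive. For a subgroup $H$ and $X\subseteq G$, $X/H=\{x+H:x\in X\}$; $A-B=\{a-b\}$. A nonzero $a$ with $X+a=X$ is a period of $X$; periods with $0$ form the subgroup of periods; $X$ is periodic if it is nontrivial, aperiodic otherwise, and $K$-periodic if $K$ (nontrivial) is its subgroup of periods. Pyramidal set: $X\subseteq G$ with $0\in X$ is pyramidal if there is a series $H_0<H_1<\cdots<H_{2t-1}\le H_{2t}=G$, $t\ge1$, such that either (a) $H_0=\{0\}$, $X$ aperiodic, and (T1) $(X/H_{2i}-X/H_{2i})\cap(H_{2i+1}/H_{2i})=\{0\}$ for $0\le i\le t-1$; (T2) $X/H_{2i-1}$ is $(H_{2i}/H_{2i-1})$-periodic for $1\le i\le t$; (T3) $|X/H_{2t-1}|=|G/H_{2t-1}|$ and $|X/H_{2i}|=|X/H_{2i+1}|$ for $0\le i\le t-1$; or (b) $H_0\ne\{0\}$, $X$ is $H_0$-periodic and $X/H_0$ satisfies (T1)–(T3) in $G/H_0$ with respect to the series $H_i/H_0$. Such a series is an admissible subgroup series associated with $X$. -}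

module Defs where

open import Level using (Level; _⊔_)
open import Algebra.Bundles using (AbelianGroup)
open import Algebra.Structures using (IsAbelianGroup)
open import Data.Nat using (ℕ; zero; suc; _+_; _*_; _∸_; _<_; _≤_)
open import Data.Product using (Σ; ∃; ∃-syntax; _×_; _,_; proj₁; proj₂)
open import Data.Sum using (_⊎_)
open import Relation.Nullary using (¬_)
open import Relation.Unary using (Pred)
open import Relation.Binary.Bundles using (Setoid)
open import Function.Bundles using (Bijection; _⇔_)
import Algebra.Properties.AbelianGroup as AGP
import Algebra.Properties.CommutativeSemigroup as CSP
import Relation.Binary.Reasoning.Setoid as SR
import Relation.Binary.Construct.On as On

-- An abelian group is the stdlib 'AbelianGroup' (written
-- multiplicatively there: _∙_ is +, ε is 0, _⁻¹ is negation, and its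
-- equality is a setoid equality _≈_).  Subsets and subgroups are
-- predicates on the carrier respecting _≈_ (at level c ⊔ ℓ,
-- so that quotients stay at a stable universe level).

module _ {c ℓ : Level} (G : AbelianGroup c ℓ) where
  open AbelianGroup G

  record Subset : Set (Level.suc (c ⊔ ℓ)) where
    field
      pred : Pred Carrier (c ⊔ ℓ)
      resp : ∀ {x y} → x ≈ y → pred x → pred y

  record Subgroup : Set (Level.suc (c ⊔ ℓ)) where
    field
      pred  : Pred Carrier (c ⊔ ℓ)
      resp  : ∀ {x y} → x ≈ y → pred x → pred y
      ε∈    : pred ε
      ∙∈    : ∀ {x y} → pred x → pred y → pred (x ∙ y)
      ⁻¹∈   : ∀ {x} → pred x → pred (x ⁻¹)

module Helpers {c ℓ : Level} (G : AbelianGroup c ℓ) where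
  open AbelianGroup G
  open AGP G
  open CSP commutativeSemigroup using (interchange)
  open SR setoid

  diff-≈ : ∀ {a b} → a ≈ b → a ∙ b ⁻¹ ≈ ε
  diff-≈ {a} {b} a≈b = trans (∙-congʳ a≈b) (inverseʳ b)

  diff-sym : ∀ x y → (x ∙ y ⁻¹) ⁻¹ ≈ y ∙ x ⁻¹
  diff-sym = ⁻¹-anti-homo-//

  diff-trans : ∀ x y z → (x ∙ y ⁻¹) ∙ (y ∙ z ⁻¹) ≈ x ∙ z ⁻¹
  diff-trans x y z = begin
    (x ∙ y ⁻¹) ∙ (y ∙ z ⁻¹)   ≈⟨ assoc _ _ _ ⟩
    x ∙ (y ⁻¹ ∙ (y ∙ z ⁻¹))   ≈⟨ ∙-congˡ (sym (assoc _ _ _)) ⟩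
    x ∙ ((y ⁻¹ ∙ y) ∙ z ⁻¹)   ≈⟨ ∙-congˡ (∙-congʳ (inverseˡ _)) ⟩
    x ∙ (ε ∙ z ⁻¹)            ≈⟨ ∙-congˡ (identityˡ _) ⟩
    x ∙ z ⁻¹                  ∎

  diff-cong : ∀ x y u v → (x ∙ y ⁻¹) ∙ (u ∙ v ⁻¹) ≈ (x ∙ u) ∙ (y ∙ v) ⁻¹
  diff-cong x y u v = begin
    (x ∙ y ⁻¹) ∙ (u ∙ v ⁻¹)   ≈⟨ interchange _ _ _ _ ⟩
    (x ∙ u) ∙ (y ⁻¹ ∙ v ⁻¹)   ≈⟨ ∙-congˡ (⁻¹-∙-comm _ _) ⟩
    (x ∙ u) ∙ (y ∙ v) ⁻¹      ∎

  diff-inv : ∀ x y → y ∙ x ⁻¹ ≈ x ⁻¹ ∙ (y ⁻¹) ⁻¹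
  diff-inv x y = begin
    y ∙ x ⁻¹             ≈⟨ comm _ _ ⟩
    x ⁻¹ ∙ y             ≈⟨ ∙-congˡ (sym (⁻¹-involutive _)) ⟩
    x ⁻¹ ∙ (y ⁻¹) ⁻¹     ∎

-- Quotients.  G / K is the abelian group with the same carrier and
-- operations, whose equality is  x ≈ y  iff  x - y ∈ K  (cosets).

infixl 7 _/ᴳ_

_/ᴳ_ : ∀ {c ℓ} (G : AbelianGroup c ℓ) → Subgroup G → AbelianGroup c (c ⊔ ℓ)
_/ᴳ_ {c} {ℓ} G K = record
  { Carrier = Carrier
  ; _≈_ = _≈K_
  ; _∙_ = _∙_
  ; ε = ε
  ; _⁻¹ = _⁻¹
  ; isAbelianGroup = record
    { isGroup = record
      { isMonoid = record
        { isSemigroup = record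
          { isMagma = record
            { isEquivalence = record { refl = K-refl ; sym = K-sym ; trans = K-trans }
            ; ∙-cong = K-cong }
          ; assoc = λ x y z → ≈⇒K (assoc x y z) }
        ; identity = (λ x → ≈⇒K (identityˡ x)) , (λ x → ≈⇒K (identityʳ x)) }
      ; inverse = (λ x → ≈⇒K (inverseˡ x)) , (λ x → ≈⇒K (inverseʳ x))
      ; ⁻¹-cong = K-inv }
    ; comm = λ x y → ≈⇒K (comm x y) } }
  where
  open AbelianGroup G
  open Helpers G
  module K = Subgroup K
  _≈K_ : Carrier → Carrier → Set (c ⊔ ℓ)
  x ≈K y = K.pred (x ∙ y ⁻¹)
  ≈⇒K : ∀ {a b} → a ≈ b → a ≈K b
  ≈⇒K e = K.resp (sym (diff-≈ e)) K.ε∈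
  K-refl : ∀ {x} → x ≈K x
  K-refl = ≈⇒K refl
  K-sym : ∀ {x y} → x ≈K y → y ≈K x
  K-sym {x} {y} p = K.resp (diff-sym x y) (K.⁻¹∈ p)
  K-trans : ∀ {x y z} → x ≈K y → y ≈K z → x ≈K z
  K-trans {x} {y} {z} p q = K.resp (diff-trans x y z) (K.∙∈ p q)
  K-cong : ∀ {x y u v} → x ≈K y → u ≈K v → (x ∙ u) ≈K (y ∙ v)
  K-cong {x} {y} {u} {v} p q = K.resp (diff-cong x y u v) (K.∙∈ p q)
  K-inv : ∀ {x y} → x ≈K y → (x ⁻¹) ≈K (y ⁻¹)
  K-inv {x} {y} p = K.resp (diff-inv x y) (K-sym p)

module _ {c ℓ : Level} {G : AbelianGroup c ℓ} where
  open AbelianGroup G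
  open Helpers G

  infixl 7 _/ˢ_ _/ᴴ_

  _/ˢ_ : Subset G → (K : Subgroup G) → Subset (G /ᴳ K)
  X /ˢ K = record
    { pred = λ x → ∃[ x' ] (X.pred x' × K.pred (x ∙ x' ⁻¹))
    ; resp = λ {x} {y} p (x' , x'∈ , q) →
        x' , x'∈ , K.resp (diff-trans y x x') (K.∙∈ (K.resp (diff-sym x y) (K.⁻¹∈ p)) q) }
    where module X = Subset X
          module K = Subgroup K

  -- H / K  =  (H + K) / K, as a subgroup of G / K
  -- (when K ⊆ H this is the usual H / K)
  _/ᴴ_ : Subgroup G → (K : Subgroup G) → Subgroup (G /ᴳ K)
  H /ᴴ K = record
    { pred = λ x → ∃[ h ] (H.pred h × K.pred (x ∙ h ⁻¹))
    ; resp = λ {x} {y} p (h , h∈ , q) →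
        h , h∈ , K.resp (diff-trans y x h) (K.∙∈ (K.resp (diff-sym x y) (K.⁻¹∈ p)) q)
    ; ε∈ = ε , H.ε∈ , K.resp (sym (diff-≈ refl)) K.ε∈
    ; ∙∈ = λ {x} {y} (h , h∈ , p) (h' , h'∈ , q) →
        h ∙ h' , H.∙∈ h∈ h'∈ , K.resp (diff-cong x h y h') (K.∙∈ p q)
    ; ⁻¹∈ = λ {x} (h , h∈ , p) →
        h ⁻¹ , H.⁻¹∈ h∈ , K.resp (diff-inv x h) (K.resp (diff-sym x h) (K.⁻¹∈ p)) }
    where module H = Subgroup H
          module K = Subgroup K

module _ {c ℓ : Level} (G : AbelianGroup c ℓ) where
  open AbelianGroup G

  translate : Subset G → Carrier → Pred Carrier (c ⊔ ℓ)
  translate X a y = ∃[ x ] (Subset.pred X x × y ≈ x ∙ a)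

  difference : Subset G → Subset G → Pred Carrier (c ⊔ ℓ)
  difference A B z = ∃[ a ] ∃[ b ] (Subset.pred A a × Subset.pred B b × z ≈ a ∙ b ⁻¹)

  IsZeroSet : Pred Carrier (c ⊔ ℓ) → Set (c ⊔ ℓ)
  IsZeroSet P = ∀ z → P z ⇔ (z ≈ ε)

  Trivial : Subgroup G → Set (c ⊔ ℓ)
  Trivial H = IsZeroSet (Subgroup.pred H)

  Nontrivial : Pred Carrier (c ⊔ ℓ) → Set (c ⊔ ℓ)
  Nontrivial P = ∃[ a ] (P a × ¬ (a ≈ ε))

  IsPeriod : Subset G → Carrier → Set (c ⊔ ℓ)
  IsPeriod X a = ¬ (a ≈ ε) × (∀ y → translate X a y ⇔ Subset.pred X y)

  Periods : Subset G → Pred Carrier (c ⊔ ℓ)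
  Periods X a = (a ≈ ε) ⊎ IsPeriod X a

  Periodic : Subset G → Set (c ⊔ ℓ)
  Periodic X = Nontrivial (Periods X)

  Aperiodic : Subset G → Set (c ⊔ ℓ)
  Aperiodic X = ¬ Periodic X

  _-periodic_ : Subset G → Subgroup G → Set (c ⊔ ℓ)
  X -periodic K = Nontrivial (Subgroup.pred K) × (∀ a → Subgroup.pred K a ⇔ Periods X a)

  _⊆ᴴ_ : Subgroup G → Subgroup G → Set (c ⊔ ℓ)
  H ⊆ᴴ H' = ∀ x → Subgroup.pred H x → Subgroup.pred H' x

  _⊂ᴴ_ : Subgroup G → Subgroup G → Set (c ⊔ ℓ)
  H ⊂ᴴ H' = H ⊆ᴴ H' × ∃[ x ] (Subgroup.pred H' x × ¬ Subgroup.pred H x)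

  IsWhole : Subgroup G → Set (c ⊔ ℓ)
  IsWhole H = ∀ x → Subgroup.pred H x

  subsetSetoid : Subset G → Setoid (c ⊔ ℓ) ℓ
  subsetSetoid X = On.setoid setoid (proj₁ {B = Subset.pred X})

_≃ᶜ_ : ∀ {a b ℓ₁ ℓ₂} → Setoid a ℓ₁ → Setoid b ℓ₂ → Set _
A ≃ᶜ B = Bijection A B

-- Conditions (T1)-(T3) for a subset X of G w.r.t. a series
-- H 0 < H 1 < ... (only indices 0 .. 2t are relevant)

module _ {c ℓ : Level} (G : AbelianGroup c ℓ) where

  TConditions : Subset G → (ℕ → Subgroup G) → ℕ → Set _
  TConditions X H t =
      (∀ i → i < t →
         IsZeroSet (G /ᴳ H (2 * i))
           (λ z → difference (G /ᴳ H (2 * i)) (X /ˢ H (2 * i)) (X /ˢ H (2 * i)) z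
                  × Subgroup.pred (H (suc (2 * i)) /ᴴ H (2 * i)) z))
      -- (T2)  X/H_{2i-1} is (H_{2i}/H_{2i-1})-periodic   (1 ≤ i ≤ t; here i ↦ i+1)
    × (∀ i → i < t →
         _-periodic_ (G /ᴳ H (suc (2 * i))) (X /ˢ H (suc (2 * i)))
                     (H (2 + 2 * i) /ᴴ H (suc (2 * i))))
    × (subsetSetoid (G /ᴳ H (2 * t ∸ 1)) (X /ˢ H (2 * t ∸ 1))
         ≃ᶜ AbelianGroup.setoid (G /ᴳ H (2 * t ∸ 1)))
    × (∀ i → i < t →
         subsetSetoid (G /ᴳ H (2 * i)) (X /ˢ H (2 * i))
           ≃ᶜ subsetSetoid (G /ᴳ H (suc (2 * i))) (X /ˢ H (suc (2 * i))))

module _ {c ℓ : Level} (G : AbelianGroup c ℓ) where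

  Admissible : Subset G → (ℕ → Subgroup G) → ℕ → Set _
  Admissible X H t =
      1 ≤ t
    × (∀ j → suc j < 2 * t → _⊂ᴴ_ G (H j) (H (suc j)))
    × _⊆ᴴ_ G (H (2 * t ∸ 1)) (H (2 * t))
    × IsWhole G (H (2 * t))
    × (
          (Trivial G (H 0) × Aperiodic G X × TConditions G X H t)
        ⊎
          (¬ Trivial G (H 0) × _-periodic_ G X (H 0)
           × TConditions (G /ᴳ H 0) (X /ˢ H 0) (λ j → H j /ᴴ H 0) t))

  PyramidalWith : Subset G → (ℕ → Subgroup G) → ℕ → Set _
  PyramidalWith X H t = Subset.pred X (AbelianGroup.ε G) × Admissible X H t

  Pyramidal : Subset G → Set _
  Pyramidal X = ∃[ t ] ∃[ H ] PyramidalWith X H t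

{-# OPTIONS --safe #-}

-- All groups involved are iterated quotients of G, and for K ≤ M the third isomorphism
-- theorem (G/K)/(M/K) ≅ G/M carries (X/K)/(M/K) to X/M and (N/K)/(M/K) to N/M.  Conditions
-- (T1)–(T3), periodicity and aperiodicity are invariant under isomorphisms respecting these
-- subsets, so the T-conditions of the quotient series are those of the original one, shifted.
-- In case (a) the new bottom group H_{2i}/H_{2i} is trivial, and X/H_{2i} is aperiodic: for i = 0
-- because X is, and for i > 0 because by (T2) it is X/H_{2i-1} divided by its whole group of
-- periods.  In case (b) the new bottom group H_{2i+2}/H_{2i+1} is, by (T2), the group of periods
-- of X/H_{2i+1}, hence nontrivial.

module Submission where

open import Level using (_⊔_)
open import Algebra.Bundles using (AbelianGroup)
import Algebra.Properties.AbelianGroup as AbelianGroupProperties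
import Algebra.Properties.Group as GroupProperties
open import Data.Empty using (⊥-elim)
open import Data.Nat using (ℕ; zero; suc; _+_; _*_; _∸_; _<_; _≤_; z≤n; s≤s)
open import Data.Nat.Properties
  using ( n≤1+n; n<1+n; <⇒≤; ≤-reflexive; ≤-trans; <-trans; m≤n⇒m<n∨m≡n; m≤m+n; m<m+n; m∸n≤m
        ; m<n⇒0<n∸m; m+[n∸m]≡n; +-suc; +-identityʳ; +-∸-assoc; +-monoʳ-≤; +-monoʳ-<
        ; *-suc; *-distribˡ-+; *-monoʳ-≤; module ≤-Reasoning )
open import Data.Product using (_×_; _,_; proj₁; proj₂; swap)
open import Data.Sum using (inj₁; inj₂)
open import Function.Bundles using (Inverse; Equivalence; mk⇔)
open import Function.Properties.Inverse using (Inverse⇒Bijection)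
import Function.Construct.Composition as Composition
import Function.Construct.Symmetry as Symmetry
open import Relation.Binary.Bundles using (Setoid)
open import Relation.Binary.PropositionalEquality as ≡ using (_≡_)
import Relation.Binary.Reasoning.Setoid as SetoidReasoning
open import Relation.Nullary using (¬_)
open import Relation.Unary using (Pred)

open import Defs

infix 4 _≅_

record _≅_ {a ℓa b ℓb} (A : AbelianGroup a ℓa) (B : AbelianGroup b ℓb) : Set (a ⊔ ℓa ⊔ b ⊔ ℓb) where
  private
    module A = AbelianGroup A
    module B = AbelianGroup B
  field
    inverse : Inverse A.setoid B.setoid
  open Inverse inverse public using (to; from; to-cong; from-cong; strictlyInverseˡ; strictlyInverseʳ)
  field
    homo : ∀ x y → to (x A.∙ y) B.≈ to x B.∙ to y

  to-ε : to A.ε B.≈ B.ε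
  to-ε = identityˡ-unique (to A.ε) (to A.ε) (B.trans (B.sym (homo A.ε A.ε)) (to-cong (A.identityˡ A.ε)))
    where open GroupProperties B.group

  to-⁻¹ : ∀ x → to (x A.⁻¹) B.≈ to x B.⁻¹
  to-⁻¹ x = inverseˡ-unique (to (x A.⁻¹)) (to x)
              (B.trans (B.sym (homo _ _)) (B.trans (to-cong (A.inverseˡ x)) to-ε))
    where open GroupProperties B.group

  to-// : ∀ x y → to (x A.∙ y A.⁻¹) B.≈ to x B.∙ to y B.⁻¹
  to-// x y = B.trans (homo x (y A.⁻¹)) (B.∙-congˡ (to-⁻¹ y))

  from-homo : ∀ x y → from (x B.∙ y) A.≈ from x A.∙ from y
  from-homo x y = begin
    from (x B.∙ y)                     ≈⟨ from-cong (B.∙-cong (B.sym (strictlyInverseˡ x))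
                                                              (B.sym (strictlyInverseˡ y))) ⟩
    from (to (from x) B.∙ to (from y)) ≈⟨ from-cong (B.sym (homo _ _)) ⟩
    from (to (from x A.∙ from y))      ≈⟨ strictlyInverseʳ _ ⟩
    from x A.∙ from y                  ∎
    where open SetoidReasoning A.setoid

open _≅_

≅-sym : ∀ {a ℓa b ℓb} {A : AbelianGroup a ℓa} {B : AbelianGroup b ℓb} → A ≅ B → B ≅ A
≅-sym φ = record { inverse = Symmetry.inverse (inverse φ) ; homo = from-homo φ }

module _ {a ℓa b ℓb} {A : AbelianGroup a ℓa} {B : AbelianGroup b ℓb} where
  private
    module A = AbelianGroup A
    module B = AbelianGroup B

  Carries : ∀ {p q} → A ≅ B → Pred A.Carrier p → Pred B.Carrier q → Set _
  Carries φ P P' = (∀ x → P x → P' (to φ x)) × (∀ y → P' y → P (from φ y))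

  to-≈ε⇒≈ε : (φ : A ≅ B) → ∀ {x} → to φ x B.≈ B.ε → x A.≈ A.ε
  to-≈ε⇒≈ε φ {x} tx≈ε = begin
    x                ≈⟨ strictlyInverseʳ φ x ⟨
    from φ (to φ x)  ≈⟨ from-cong φ tx≈ε ⟩
    from φ B.ε       ≈⟨ to-ε (≅-sym φ) ⟩
    A.ε              ∎
    where open SetoidReasoning A.setoid

  nontrivial-transport : ∀ {P : Pred A.Carrier (a ⊔ ℓa)} {P' : Pred B.Carrier (b ⊔ ℓb)} (φ : A ≅ B) →
                         (∀ x → P x → P' (to φ x)) → Nontrivial A P → Nontrivial B P'
  nontrivial-transport φ P→P' (x , Px , x≉ε) = to φ x , P→P' x Px , λ tx≈ε → x≉ε (to-≈ε⇒≈ε φ tx≈ε)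

  periods-transport : ∀ {Y : Subset A} {Y' : Subset B} (φ : A ≅ B) →
                      Carries φ (Subset.pred Y) (Subset.pred Y') →
                      ∀ x → Periods A Y x → Periods B Y' (to φ x)
  periods-transport φ _ x (inj₁ x≈ε) = inj₁ (B.trans (to-cong φ x≈ε) (to-ε φ))
  periods-transport {Y} {Y'} φ (Y→Y' , Y'→Y) x (inj₂ (x≉ε , period)) =
    inj₂ ((λ tx≈ε → x≉ε (to-≈ε⇒≈ε φ tx≈ε)) , λ y → mk⇔ (shifted y) (unshifted y))
    where
    shifted : ∀ y → translate B Y' (to φ x) y → Subset.pred Y' y
    shifted y (z , Y'z , y≈z+tx) =
      Subset.resp Y' (strictlyInverseˡ φ y) (Y→Y' _ (Equivalence.to (period (from φ y))
        (from φ z , Y'→Y z Y'z ,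
         A.trans (from-cong φ y≈z+tx) (A.trans (from-homo φ _ _) (A.∙-congˡ (strictlyInverseʳ φ x))))))
    unshifted : ∀ y → Subset.pred Y' y → translate B Y' (to φ x) y
    unshifted y Y'y =
      let (z , Yz , fy≈z+x) = Equivalence.from (period (from φ y)) (Y'→Y y Y'y)
      in to φ z , Y→Y' z Yz ,
         B.trans (B.sym (strictlyInverseˡ φ y)) (B.trans (to-cong φ fy≈z+x) (homo φ _ _))

  difference-transport : ∀ {Y : Subset A} {Y' : Subset B} (φ : A ≅ B) →
                         (∀ x → Subset.pred Y x → Subset.pred Y' (to φ x)) →
                         ∀ z → difference A Y Y z → difference B Y' Y' (to φ z)
  difference-transport φ Y→Y' z (u , v , Yu , Yv , z≈u-v) =
    to φ u , to φ v , Y→Y' u Yu , Y→Y' v Yv , B.trans (to-cong φ z≈u-v) (to-// φ u v)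

  subset-inverse : ∀ {Y : Subset A} {Y' : Subset B} (φ : A ≅ B) →
                   Carries φ (Subset.pred Y) (Subset.pred Y') →
                   Inverse (subsetSetoid A Y) (subsetSetoid B Y')
  subset-inverse φ (Y→Y' , Y'→Y) = record
    { to        = λ (x , Yx) → to φ x , Y→Y' x Yx
    ; from      = λ (y , Y'y) → from φ y , Y'→Y y Y'y
    ; to-cong   = to-cong φ
    ; from-cong = from-cong φ
    ; inverse   = Inverse.inverseˡ (inverse φ) , Inverse.inverseʳ (inverse φ)
    }

module _ {c ℓ} (G : AbelianGroup c ℓ) where
  open AbelianGroup G

  periods-resp : ∀ (Y : Subset G) {x y} → x ≈ y → Periods G Y x → Periods G Y y
  periods-resp Y x≈y (inj₁ x≈ε) = inj₁ (trans (sym x≈y) x≈ε)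
  periods-resp Y x≈y (inj₂ (x≉ε , period)) = inj₂ ((λ y≈ε → x≉ε (trans x≈y y≈ε)) , λ z → mk⇔
    (λ (w , Yw , z≈w+y) → Equivalence.to (period z) (w , Yw , trans z≈w+y (∙-congˡ (sym x≈y))))
    (λ Yz → let (w , Yw , z≈w+x) = Equivalence.from (period z) Yz in w , Yw , trans z≈w+x (∙-congˡ x≈y)))

  difference-resp : ∀ (Y : Subset G) {x y} → x ≈ y → difference G Y Y x → difference G Y Y y
  difference-resp Y x≈y (u , v , Yu , Yv , x≈u-v) = u , v , Yu , Yv , trans (sym x≈y) x≈u-v

module _ {a ℓa b ℓb} {A : AbelianGroup a ℓa} {B : AbelianGroup b ℓb} where
  private
    module A = AbelianGroup A
    module B = AbelianGroup B

  aperiodic-transport : ∀ {Y : Subset A} {Y' : Subset B} (φ : A ≅ B) →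
                        Carries φ (Subset.pred Y) (Subset.pred Y') → Aperiodic A Y → Aperiodic B Y'
  aperiodic-transport {Y} {Y'} φ carries aperiodic periodic' =
    aperiodic (nontrivial-transport (≅-sym φ) (periods-transport {Y = Y'} {Y} (≅-sym φ) (swap carries)) periodic')

  periodic-transport : ∀ {Y : Subset A} {Y' : Subset B} {L : Subgroup A} {L' : Subgroup B} (φ : A ≅ B) →
                       Carries φ (Subset.pred Y) (Subset.pred Y') →
                       Carries φ (Subgroup.pred L) (Subgroup.pred L') →
                       _-periodic_ A Y L → _-periodic_ B Y' L'
  periodic-transport {Y} {Y'} {L} {L'} φ carriesY (L→L' , L'→L) (nontrivial , L⇔periods) =
    nontrivial-transport {P = Subgroup.pred L} {Subgroup.pred L'} φ L→L' nontrivial , λ y → mk⇔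
      (λ L'y → periods-resp B Y' (strictlyInverseˡ φ y)
                 (periods-transport {Y = Y} {Y'} φ carriesY _ (Equivalence.to (L⇔periods _) (L'→L y L'y))))
      (λ periodY' → Subgroup.resp L' (strictlyInverseˡ φ y)
                 (L→L' _ (Equivalence.from (L⇔periods _)
                            (periods-transport {Y = Y'} {Y} (≅-sym φ) (swap carriesY) y periodY'))))

  zero-difference-transport : ∀ {Y : Subset A} {Y' : Subset B} {L : Subgroup A} {L' : Subgroup B} (φ : A ≅ B) →
    Carries φ (Subset.pred Y) (Subset.pred Y') → Carries φ (Subgroup.pred L) (Subgroup.pred L') →
    IsZeroSet A (λ z → difference A Y Y z × Subgroup.pred L z) →
    IsZeroSet B (λ z → difference B Y' Y' z × Subgroup.pred L' z)
  zero-difference-transport {Y} {Y'} {L} {L'} φ (Y→Y' , Y'→Y) (L→L' , L'→L) isZero z = mk⇔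
    (λ (Dz , L'z) → to-≈ε⇒≈ε (≅-sym φ)
       (Equivalence.to (isZero (from φ z)) (difference-transport {Y = Y'} {Y} (≅-sym φ) Y'→Y z Dz , L'→L z L'z)))
    (λ z≈ε → let (Dfz , Lfz) = Equivalence.from (isZero (from φ z)) (A.trans (from-cong φ z≈ε) (to-ε (≅-sym φ)))
             in difference-resp B Y' (strictlyInverseˡ φ z) (difference-transport {Y = Y} {Y'} φ Y→Y' _ Dfz)
              , Subgroup.resp L' (strictlyInverseˡ φ z) (L→L' _ Lfz))

≃ᶜ-transport : ∀ {s₁ ℓ₁ s₂ ℓ₂ t₁ ℓ₃ t₂ ℓ₄}
                 {S : Setoid s₁ ℓ₁} {S' : Setoid s₂ ℓ₂} {T : Setoid t₁ ℓ₃} {T' : Setoid t₂ ℓ₄} →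
               Inverse S S' → Inverse T T' → S ≃ᶜ T → S' ≃ᶜ T'
≃ᶜ-transport S↔S' T↔T' S≃T =
  Composition.bijection (Inverse⇒Bijection (Symmetry.inverse S↔S'))
                        (Composition.bijection S≃T (Inverse⇒Bijection T↔T'))

module _ {c ℓ} {G : AbelianGroup c ℓ} where
  open AbelianGroup G
  open GroupProperties group using (x≈y⇒x∙y⁻¹≈ε; x∙y⁻¹≈ε⇒x≈y; //-rightDividesˡ)

  -- N /ᴴ K and asSubset N /ˢ K have the same predicate, so facts about
  -- quotients of subsets apply verbatim to quotients of subgroups.
  asSubset : Subgroup G → Subset G
  asSubset N = record { pred = Subgroup.pred N ; resp = Subgroup.resp N }

  ≈⇒≈/ : ∀ (K : Subgroup G) {x y} → x ≈ y → AbelianGroup._≈_ (G /ᴳ K) x y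
  ≈⇒≈/ K x≈y = Subgroup.resp K (sym (x≈y⇒x∙y⁻¹≈ε x≈y)) (Subgroup.ε∈ K)

  //∈-cancelʳ : ∀ (K : Subgroup G) {x y} → Subgroup.pred K (x ∙ y ⁻¹) → Subgroup.pred K y → Subgroup.pred K x
  //∈-cancelʳ K {x} {y} Kx-y Ky = Subgroup.resp K (//-rightDividesˡ y x) (Subgroup.∙∈ K Kx-y Ky)

  /ᴴ-⊆ : ∀ (K M : Subgroup G) → _⊆ᴴ_ G K M → ∀ x → Subgroup.pred (M /ᴴ K) x → Subgroup.pred M x
  /ᴴ-⊆ K M K⊆M x (h , Mh , Kx-h) = //∈-cancelʳ M (K⊆M _ Kx-h) Mh

  ⊆-/ˢ : ∀ (K : Subgroup G) (Y : Subset G) → ∀ x → Subset.pred Y x → Subset.pred (Y /ˢ K) x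
  ⊆-/ˢ K Y x Yx = x , Yx , ≈⇒≈/ K refl

  /ᴴ-mono : ∀ (K : Subgroup G) {M N : Subgroup G} → _⊆ᴴ_ G M N → _⊆ᴴ_ (G /ᴳ K) (M /ᴴ K) (N /ᴴ K)
  /ᴴ-mono K M⊆N x (h , Mh , Kx-h) = h , M⊆N h Mh , Kx-h

  /ᴴ-strict : ∀ {K M N : Subgroup G} → _⊆ᴴ_ G K M → _⊂ᴴ_ G M N → _⊂ᴴ_ (G /ᴳ K) (M /ᴴ K) (N /ᴴ K)
  /ᴴ-strict {K} {M} {N} K⊆M (M⊆N , x , Nx , x∉M) =
    /ᴴ-mono K {M} {N} M⊆N , x , ⊆-/ˢ K (asSubset N) x Nx , λ x∈M/K → x∉M (/ᴴ-⊆ K M K⊆M x x∈M/K)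

  /ᴴ-whole : ∀ (K : Subgroup G) {N : Subgroup G} → IsWhole G N → IsWhole (G /ᴳ K) (N /ᴴ K)
  /ᴴ-whole K {N} whole x = ⊆-/ˢ K (asSubset N) x (whole x)

  /ᴴ-trivial : ∀ {K N : Subgroup G} → _⊆ᴴ_ G N K → Trivial (G /ᴳ K) (N /ᴴ K)
  /ᴴ-trivial {K} {N} N⊆K x = mk⇔
    (λ x∈N/K → Subgroup.∙∈ K (/ᴴ-⊆ K K (λ _ Ky → Ky) x (/ᴴ-mono K {N} {K} N⊆K x x∈N/K))
                             (Subgroup.⁻¹∈ K (Subgroup.ε∈ K)))
    (λ x≈ε → ε , Subgroup.ε∈ N , x≈ε)

  nontrivial⇒¬trivial : ∀ {N : Subgroup G} → Nontrivial G (Subgroup.pred N) → ¬ Trivial G N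
  nontrivial⇒¬trivial (x , Nx , x≉ε) trivial = x≉ε (Equivalence.to (trivial x) Nx)

  trivial-≅ : ∀ (K : Subgroup G) → Trivial G K → G ≅ G /ᴳ K
  trivial-≅ K trivial = record
    { inverse = record
      { to        = λ x → x
      ; from      = λ x → x
      ; to-cong   = ≈⇒≈/ K
      ; from-cong = K⇒≈
      ; inverse   = ≈⇒≈/ K , K⇒≈
      }
    ; homo    = λ _ _ → ≈⇒≈/ K refl
    }
    where
    K⇒≈ : ∀ {x y} → Subgroup.pred K (x ∙ y ⁻¹) → x ≈ y
    K⇒≈ {x} {y} Kx-y = x∙y⁻¹≈ε⇒x≈y x y (Equivalence.to (trivial _) Kx-y)

  trivial-carries : ∀ (K : Subgroup G) (trivial : Trivial G K) (Y : Subset G) →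
                    Carries (trivial-≅ K trivial) (Subset.pred Y) (Subset.pred (Y /ˢ K))
  trivial-carries K trivial Y =
    ⊆-/ˢ K Y , (λ x (y , Yy , Kx-y) → Subset.resp Y (sym (from-cong (trivial-≅ K trivial) Kx-y)) Yy)

  third-≅ : ∀ (K M : Subgroup G) → _⊆ᴴ_ G K M → (G /ᴳ K) /ᴳ (M /ᴴ K) ≅ G /ᴳ M
  third-≅ K M K⊆M = record
    { inverse = record
      { to        = λ x → x
      ; from      = λ x → x
      ; to-cong   = /ᴴ-⊆ K M K⊆M _
      ; from-cong = ⊆-/ˢ K (asSubset M) _
      ; inverse   = /ᴴ-⊆ K M K⊆M _ , ⊆-/ˢ K (asSubset M) _
      }
    ; homo    = λ _ _ → ≈⇒≈/ M refl
    }

  third-carries : ∀ (K M : Subgroup G) (K⊆M : _⊆ᴴ_ G K M) (Y : Subset G) →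
                  Carries (third-≅ K M K⊆M) (Subset.pred ((Y /ˢ K) /ˢ (M /ᴴ K))) (Subset.pred (Y /ˢ M))
  third-carries K M K⊆M Y =
      (λ x (y , (z , Yz , Ky-z) , M/Kx-y) →
         z , Yz , Subgroup.resp M (Helpers.diff-trans G x y z)
                    (Subgroup.∙∈ M (/ᴴ-⊆ K M K⊆M _ M/Kx-y) (K⊆M _ Ky-z)))
    , (λ x (z , Yz , Mx-z) → z , ⊆-/ˢ K Y z Yz , ⊆-/ˢ K (asSubset M) _ Mx-z)

  periodic⇒absorbs : ∀ {Y : Subset G} {L : Subgroup G} → _-periodic_ G Y L →
                     ∀ x → Subset.pred (Y /ˢ L) x → Subset.pred Y x
  periodic⇒absorbs {Y} (_ , L⇔periods) x (y , Yy , Lx-y) with Equivalence.to (L⇔periods _) Lx-y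
  ... | inj₁ x-y≈ε = Subset.resp Y (sym (x∙y⁻¹≈ε⇒x≈y x y x-y≈ε)) Yy
  ... | inj₂ (_ , translate⇔) = Equivalence.to (translate⇔ x) (y , Yy , x≈y+[x-y])
    where
    open AbelianGroupProperties G using (xyx⁻¹≈y)
    x≈y+[x-y] : x ≈ y ∙ (x ∙ y ⁻¹)
    x≈y+[x-y] = sym (trans (sym (assoc y x (y ⁻¹))) (xyx⁻¹≈y y x))

  periodic⇒quotient-aperiodic : ∀ {Y : Subset G} {L : Subgroup G} → _-periodic_ G Y L →
                                Aperiodic (G /ᴳ L) (Y /ˢ L)
  periodic⇒quotient-aperiodic _ (a , inj₁ a≈ε , a≉ε) = a≉ε a≈ε
  periodic⇒quotient-aperiodic {Y} {L} periodic (a , inj₂ (_ , translate⇔) , a≉ε) =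
    a≉ε (Subgroup.∙∈ L a∈L (Subgroup.⁻¹∈ L (Subgroup.ε∈ L)))
    where
    open GroupProperties (AbelianGroup.group (G /ᴳ L)) using (x≈z//y)
    shifted : ∀ y → translate G Y a y → Subset.pred Y y
    shifted y (x , Yx , y≈x+a) =
      periodic⇒absorbs {Y} {L} periodic y (Equivalence.to (translate⇔ y) (x , ⊆-/ˢ L Y x Yx , ≈⇒≈/ L y≈x+a))
    unshifted : ∀ y → Subset.pred Y y → translate G Y a y
    unshifted y Yy =
      let (x , x∈Y/L , y≈x+a) = Equivalence.from (translate⇔ y) (⊆-/ˢ L Y y Yy)
          x≈y-a = x≈z//y x a y (AbelianGroup.sym (G /ᴳ L) y≈x+a)
      in y ∙ a ⁻¹ , periodic⇒absorbs {Y} {L} periodic _ (Subset.resp (Y /ˢ L) x≈y-a x∈Y/L)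
                  , sym (//-rightDividesˡ a y)
    a∈L : Subgroup.pred L a
    a∈L = Equivalence.from (proj₂ periodic a)
            (inj₂ ((λ a≈ε → a≉ε (≈⇒≈/ L a≈ε)) , λ y → mk⇔ (shifted y) (unshifted y)))

record Matching {j a ℓa b ℓb} {J : Set j}
                (A : AbelianGroup a ℓa) (Y : Subset A) (L : J → Subgroup A)
                (B : AbelianGroup b ℓb) (Y' : Subset B) (L' : J → Subgroup B) : Set (j ⊔ a ⊔ ℓa ⊔ b ⊔ ℓb) where
  field
    iso               : A ≅ B
    carries-subset    : Carries iso (Subset.pred Y) (Subset.pred Y')
    carries-subgroups : ∀ i → Carries iso (Subgroup.pred (L i)) (Subgroup.pred (L' i))

module _ {j} {J : Set j} where

  matching-sym : ∀ {a ℓa b ℓb} {A : AbelianGroup a ℓa} {Y : Subset A} {L : J → Subgroup A}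
                   {B : AbelianGroup b ℓb} {Y' : Subset B} {L' : J → Subgroup B} →
                 Matching A Y L B Y' L' → Matching B Y' L' A Y L
  matching-sym M = record
    { iso               = ≅-sym iso
    ; carries-subset    = swap carries-subset
    ; carries-subgroups = λ i → swap (carries-subgroups i)
    }
    where open Matching M

  third-matching : ∀ {c ℓ} {G : AbelianGroup c ℓ} (X : Subset G) (N : J → Subgroup G) (K M : Subgroup G) →
                   _⊆ᴴ_ G K M →
                   Matching ((G /ᴳ K) /ᴳ (M /ᴴ K)) ((X /ˢ K) /ˢ (M /ᴴ K)) (λ i → (N i /ᴴ K) /ᴴ (M /ᴴ K))
                            (G /ᴳ M) (X /ˢ M) (λ i → N i /ᴴ M)
  third-matching X N K M K⊆M = record
    { iso               = third-≅ K M K⊆M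
    ; carries-subset    = third-carries K M K⊆M X
    ; carries-subgroups = λ i → third-carries K M K⊆M (asSubset (N i))
    }

2+2*k≤2*s : ∀ {k s} → k < s → 2 + 2 * k ≤ 2 * s
2+2*k≤2*s {k} {s} k<s = ≡.subst (_≤ 2 * s) (*-suc 2 k) (*-monoʳ-≤ 2 k<s)

module _ {c ℓ} {A : AbelianGroup c ℓ} {Y : Subset A} {L : ℕ → Subgroup A} where

  TConditions-shift : ∀ d i s → d ≡ 2 * i → 1 ≤ s →
                      TConditions A Y L (i + s) → TConditions A Y (λ j → L (d + j)) s
  TConditions-shift _ i s ≡.refl 1≤s (t1 , t2 , t3-full , t3-equal) =
      (λ k k<s → ≡.subst₂ T1 (2[i+k]≡2i+2k k) (1+2[i+k]≡2i+[1+2k] k) (t1 (i + k) (+-monoʳ-< i k<s)))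
    , (λ k k<s → ≡.subst₂ T2 (1+2[i+k]≡2i+[1+2k] k) (2+2[i+k]≡2i+[2+2k] k) (t2 (i + k) (+-monoʳ-< i k<s)))
    , ≡.subst T3-full 2[i+s]∸1≡2i+[2s∸1] t3-full
    , (λ k k<s → ≡.subst₂ T3-equal (2[i+k]≡2i+2k k) (1+2[i+k]≡2i+[1+2k] k)
                                   (t3-equal (i + k) (+-monoʳ-< i k<s)))
    where
    T1 : ℕ → ℕ → Set _
    T1 m n = IsZeroSet (A /ᴳ L m)
               (λ z → difference (A /ᴳ L m) (Y /ˢ L m) (Y /ˢ L m) z × Subgroup.pred (L n /ᴴ L m) z)
    T2 : ℕ → ℕ → Set _
    T2 m n = _-periodic_ (A /ᴳ L m) (Y /ˢ L m) (L n /ᴴ L m)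
    T3-full : ℕ → Set _
    T3-full m = subsetSetoid (A /ᴳ L m) (Y /ˢ L m) ≃ᶜ AbelianGroup.setoid (A /ᴳ L m)
    T3-equal : ℕ → ℕ → Set _
    T3-equal m n = subsetSetoid (A /ᴳ L m) (Y /ˢ L m) ≃ᶜ subsetSetoid (A /ᴳ L n) (Y /ˢ L n)

    2[i+k]≡2i+2k : ∀ k → 2 * (i + k) ≡ 2 * i + 2 * k
    2[i+k]≡2i+2k = *-distribˡ-+ 2 i
    1+2[i+k]≡2i+[1+2k] : ∀ k → suc (2 * (i + k)) ≡ 2 * i + suc (2 * k)
    1+2[i+k]≡2i+[1+2k] k = ≡.trans (≡.cong suc (2[i+k]≡2i+2k k)) (≡.sym (+-suc (2 * i) (2 * k)))
    2+2[i+k]≡2i+[2+2k] : ∀ k → 2 + 2 * (i + k) ≡ 2 * i + (2 + 2 * k)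
    2+2[i+k]≡2i+[2+2k] k = ≡.trans (≡.cong suc (1+2[i+k]≡2i+[1+2k] k)) (≡.sym (+-suc (2 * i) (suc (2 * k))))
    2[i+s]∸1≡2i+[2s∸1] : 2 * (i + s) ∸ 1 ≡ 2 * i + (2 * s ∸ 1)
    2[i+s]∸1≡2i+[2s∸1] = ≡.trans (≡.cong (_∸ 1) (2[i+k]≡2i+2k s))
                                 (+-∸-assoc (2 * i) (≤-trans (n≤1+n 1) (*-monoʳ-≤ 2 1≤s)))

module _ {a ℓa b ℓb} {A : AbelianGroup a ℓa} {Y : Subset A} {L : ℕ → Subgroup A}
         {B : AbelianGroup b ℓb} {Y' : Subset B} {L' : ℕ → Subgroup B} where

  QuotientsMatch : ℕ → Set _
  QuotientsMatch n =
    Matching (A /ᴳ L n) (Y /ˢ L n) (λ m → L m /ᴴ L n) (B /ᴳ L' n) (Y' /ˢ L' n) (λ m → L' m /ᴴ L' n)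

  TConditions-transport : ∀ s → (∀ n → n ≤ 2 * s → QuotientsMatch n) →
                          TConditions A Y L s → TConditions B Y' L' s
  TConditions-transport s match (t1 , t2 , t3-full , t3-equal) =
      (λ k k<s → let open Matching (match (2 * k) (even≤ k<s)) in
         zero-difference-transport {Y = Y /ˢ L (2 * k)} {Y' /ˢ L' (2 * k)}
           {L (suc (2 * k)) /ᴴ L (2 * k)} {L' (suc (2 * k)) /ᴴ L' (2 * k)}
           iso carries-subset (carries-subgroups (suc (2 * k))) (t1 k k<s))
    , (λ k k<s → let open Matching (match (suc (2 * k)) (odd≤ k<s)) in
         periodic-transport {Y = Y /ˢ L (suc (2 * k))} {Y' /ˢ L' (suc (2 * k))}
           {L (2 + 2 * k) /ᴴ L (suc (2 * k))} {L' (2 + 2 * k) /ᴴ L' (suc (2 * k))}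
           iso carries-subset (carries-subgroups (2 + 2 * k)) (t2 k k<s))
    , ≃ᶜ-transport (subset-inverse-at (2 * s ∸ 1) (m∸n≤m (2 * s) 1))
                   (_≅_.inverse (Matching.iso (match (2 * s ∸ 1) (m∸n≤m (2 * s) 1)))) t3-full
    , (λ k k<s → ≃ᶜ-transport (subset-inverse-at (2 * k) (even≤ k<s))
                              (subset-inverse-at (suc (2 * k)) (odd≤ k<s)) (t3-equal k k<s))
    where
    odd≤ : ∀ {k} → k < s → suc (2 * k) ≤ 2 * s
    odd≤ k<s = <⇒≤ (2+2*k≤2*s k<s)
    even≤ : ∀ {k} → k < s → 2 * k ≤ 2 * s
    even≤ k<s = <⇒≤ (odd≤ k<s)
    subset-inverse-at : ∀ n → n ≤ 2 * s →
                        Inverse (subsetSetoid (A /ᴳ L n) (Y /ˢ L n)) (subsetSetoid (B /ᴳ L' n) (Y' /ˢ L' n))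
    subset-inverse-at n n≤2s = subset-inverse {Y = Y /ˢ L n} {Y' /ˢ L' n} iso carries-subset
      where open Matching (match n n≤2s)

module _ {c ℓ} {G : AbelianGroup c ℓ} {X : Subset G} where

  TConditions-quotient : ∀ (K : Subgroup G) (S : ℕ → Subgroup G) s → (∀ n → n ≤ 2 * s → _⊆ᴴ_ G K (S n)) →
                         TConditions G X S s → TConditions (G /ᴳ K) (X /ˢ K) (λ j → S j /ᴴ K) s
  TConditions-quotient K S s K⊆S =
    TConditions-transport {A = G} {X} {S} {G /ᴳ K} {X /ˢ K} {λ j → S j /ᴴ K} s
      (λ n n≤2s → matching-sym (third-matching X S K (S n) (K⊆S n n≤2s)))

  TConditions-unquotient : ∀ (K : Subgroup G) (S : ℕ → Subgroup G) s → (∀ n → n ≤ 2 * s → _⊆ᴴ_ G K (S n)) →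
                           TConditions (G /ᴳ K) (X /ˢ K) (λ j → S j /ᴴ K) s → TConditions G X S s
  TConditions-unquotient K S s K⊆S =
    TConditions-transport {A = G /ᴳ K} {X /ˢ K} {λ j → S j /ᴴ K} {G} {X} {S} s
      (λ n n≤2s → third-matching X S K (S n) (K⊆S n n≤2s))

record SubgroupSeries {c ℓ} (G : AbelianGroup c ℓ) (H : ℕ → Subgroup G) (t : ℕ) : Set (c ⊔ ℓ) where
  field
    increasing : ∀ j → suc j < 2 * t → _⊂ᴴ_ G (H j) (H (suc j))
    last-⊆     : _⊆ᴴ_ G (H (2 * t ∸ 1)) (H (2 * t))
    last-whole : IsWhole G (H (2 * t))

module _ {c ℓ} {G : AbelianGroup c ℓ} {H : ℕ → Subgroup G} where

  ≡⇒⊆ᴴ : ∀ {m n} → m ≡ n → _⊆ᴴ_ G (H m) (H n)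
  ≡⇒⊆ᴴ ≡.refl _ Hx = Hx

  series-step : ∀ {t} → SubgroupSeries G H t → ∀ j → suc j ≤ 2 * t → _⊆ᴴ_ G (H j) (H (suc j))
  series-step series j j+1≤2t with m≤n⇒m<n∨m≡n j+1≤2t
  ... | inj₁ j+1<2t = proj₁ (SubgroupSeries.increasing series j j+1<2t)
  ... | inj₂ j+1≡2t = λ x Hjx → ≡⇒⊆ᴴ (≡.sym j+1≡2t) x
                                 (SubgroupSeries.last-⊆ series x (≡⇒⊆ᴴ (≡.cong (_∸ 1) j+1≡2t) x Hjx))

  series-mono : ∀ {t} → SubgroupSeries G H t → ∀ {j k} → j ≤ k → k ≤ 2 * t → _⊆ᴴ_ G (H j) (H k)
  series-mono series {k = zero} z≤n _ = λ _ Hx → Hx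
  series-mono series {j} {suc k} j≤k+1 k+1≤2t with m≤n⇒m<n∨m≡n j≤k+1
  ... | inj₁ (s≤s j≤k) = λ x Hjx → series-step series k k+1≤2t x (series-mono series j≤k (<⇒≤ k+1≤2t) x Hjx)
  ... | inj₂ j≡k+1     = ≡⇒⊆ᴴ j≡k+1

  series-shift : ∀ {d i s} → SubgroupSeries G H (i + s) → d ≡ 2 * i → SubgroupSeries G (λ j → H (d + j)) s
  series-shift {i = i} {s} series ≡.refl = record
    { increasing = λ j j+1<2s → ≡.subst (λ n → _⊂ᴴ_ G (H (2 * i + j)) (H n)) (≡.sym (+-suc (2 * i) j))
                                  (increasing (2 * i + j) (shifted-< j+1<2s))
    ; last-⊆     = series-mono series (+-monoʳ-≤ (2 * i) (m∸n≤m (2 * s) 1)) (≤-reflexive (≡.sym 2[i+s]≡2i+2s))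
    ; last-whole = ≡.subst (λ n → IsWhole G (H n)) 2[i+s]≡2i+2s last-whole
    }
    where
    open SubgroupSeries series
    2[i+s]≡2i+2s : 2 * (i + s) ≡ 2 * i + 2 * s
    2[i+s]≡2i+2s = *-distribˡ-+ 2 i s
    shifted-< : ∀ {j} → suc j < 2 * s → suc (2 * i + j) < 2 * (i + s)
    shifted-< {j} j+1<2s = begin-strict
      suc (2 * i + j)  ≡⟨ +-suc (2 * i) j ⟨
      2 * i + suc j    <⟨ +-monoʳ-< (2 * i) j+1<2s ⟩
      2 * i + 2 * s    ≡⟨ 2[i+s]≡2i+2s ⟨
      2 * (i + s)      ∎
      where open ≤-Reasoning

  series-quotient : ∀ {s} (K : Subgroup G) → SubgroupSeries G H s → _⊆ᴴ_ G K (H 0) →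
                    SubgroupSeries (G /ᴳ K) (λ j → H j /ᴴ K) s
  series-quotient {s} K series K⊆H₀ = record
    { increasing = λ j j+1<2s → /ᴴ-strict {K = K} {H j} {H (suc j)}
                                  (λ x Kx → series-mono series z≤n (<⇒≤ (<⇒≤ j+1<2s)) x (K⊆H₀ x Kx))
                                  (increasing j j+1<2s)
    ; last-⊆     = /ᴴ-mono K {H (2 * s ∸ 1)} {H (2 * s)} last-⊆
    ; last-whole = /ᴴ-whole K {H (2 * s)} last-whole
    }
    where open SubgroupSeries series

module _ {c ℓ} {G : AbelianGroup c ℓ} {X : Subset G} where

  pyramidal-quotient-aperiodic : ∀ (K : Subgroup G) (S : ℕ → Subgroup G) s →
    Subset.pred X (AbelianGroup.ε G) → 1 ≤ s → SubgroupSeries G S s → _⊆ᴴ_ G (S 0) K → _⊆ᴴ_ G K (S 0) →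
    Aperiodic (G /ᴳ K) (X /ˢ K) → TConditions G X S s →
    PyramidalWith (G /ᴳ K) (X /ˢ K) (λ j → S j /ᴴ K) s
  pyramidal-quotient-aperiodic K S s ε∈X 1≤s series S₀⊆K K⊆S₀ aperiodic conditions =
      ⊆-/ˢ K X _ ε∈X , 1≤s , increasing , last-⊆ , last-whole
    , inj₁ (/ᴴ-trivial {K = K} {S 0} S₀⊆K , aperiodic , TConditions-quotient {X = X} K S s K⊆S conditions)
    where
    open SubgroupSeries (series-quotient K series K⊆S₀)
    K⊆S : ∀ n → n ≤ 2 * s → _⊆ᴴ_ G K (S n)
    K⊆S n n≤2s x Kx = series-mono series z≤n n≤2s x (K⊆S₀ x Kx)

  pyramidal-quotient-periodic : ∀ (K : Subgroup G) (S : ℕ → Subgroup G) s →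
    Subset.pred X (AbelianGroup.ε G) → 1 ≤ s → SubgroupSeries G S s → _⊆ᴴ_ G K (S 0) →
    _-periodic_ (G /ᴳ K) (X /ˢ K) (S 0 /ᴴ K) → TConditions G X S s →
    PyramidalWith (G /ᴳ K) (X /ˢ K) (λ j → S j /ᴴ K) s
  pyramidal-quotient-periodic K S s ε∈X 1≤s series K⊆S₀ periodic conditions =
      ⊆-/ˢ K X _ ε∈X , 1≤s , increasing , last-⊆ , last-whole
    , inj₂ ( nontrivial⇒¬trivial {N = S 0 /ᴴ K} (proj₁ periodic)
           , periodic
           , TConditions-quotient {X = X /ˢ K} (S 0 /ᴴ K) (λ j → S j /ᴴ K) s
               (λ n n≤2s → /ᴴ-mono K {S 0} {S n} (S₀⊆S n n≤2s))
               (TConditions-quotient {X = X} K S s K⊆S conditions))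
    where
    open SubgroupSeries (series-quotient K series K⊆S₀)
    S₀⊆S : ∀ n → n ≤ 2 * s → _⊆ᴴ_ G (S 0) (S n)
    S₀⊆S n n≤2s = series-mono series z≤n n≤2s
    K⊆S : ∀ n → n ≤ 2 * s → _⊆ᴴ_ G K (S n)
    K⊆S n n≤2s x Kx = S₀⊆S n n≤2s x (K⊆S₀ x Kx)

module _ {c ℓ} {G : AbelianGroup c ℓ} {X : Subset G} {H : ℕ → Subgroup G} where

  pyramidal-series : ∀ {t} → PyramidalWith G X H t → SubgroupSeries G H t
  pyramidal-series (_ , _ , increasing , last-⊆ , last-whole , _) =
    record { increasing = increasing ; last-⊆ = last-⊆ ; last-whole = last-whole }

  even-quotient-aperiodic : ∀ {t} → SubgroupSeries G H t → Trivial G (H 0) → Aperiodic G X →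
    (∀ i → i < t → _-periodic_ (G /ᴳ H (suc (2 * i))) (X /ˢ H (suc (2 * i))) (H (2 + 2 * i) /ᴴ H (suc (2 * i)))) →
    ∀ i → i < t → Aperiodic (G /ᴳ H (2 * i)) (X /ˢ H (2 * i))
  even-quotient-aperiodic _ trivial aperiodic _ zero _ =
    aperiodic-transport {Y = X} {X /ˢ H 0} (trivial-≅ (H 0) trivial) (trivial-carries (H 0) trivial X) aperiodic
  even-quotient-aperiodic series _ _ periodic (suc i) i+1<t =
    ≡.subst (λ n → Aperiodic (G /ᴳ H n) (X /ˢ H n)) (≡.sym (*-suc 2 i))
      (aperiodic-transport {Y = (X /ˢ K) /ˢ (M /ᴴ K)} {X /ˢ M} (third-≅ K M K⊆M) (third-carries K M K⊆M X)
        (periodic⇒quotient-aperiodic {Y = X /ˢ K} {M /ᴴ K} (periodic i i<t)))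
    where
    K M : Subgroup G
    K = H (suc (2 * i))
    M = H (2 + 2 * i)
    i<t : i < _
    i<t = <-trans (n<1+n i) i+1<t
    K⊆M : _⊆ᴴ_ G K M
    K⊆M = series-mono series (n≤1+n _) (2+2*k≤2*s i<t)

  even-quotient-pyramidal : ∀ i s → 1 ≤ s → PyramidalWith G X H (i + s) → Trivial G (H 0) →
    PyramidalWith (G /ᴳ H (2 * i)) (X /ˢ H (2 * i)) (λ j → H (2 * i + j) /ᴴ H (2 * i)) s
  even-quotient-pyramidal i s 1≤s (_ , _ , _ , _ , _ , inj₂ (nontrivial , _)) trivial = ⊥-elim (nontrivial trivial)
  even-quotient-pyramidal i s 1≤s pyramidal@(ε∈X , _ , _ , _ , _ , inj₁ (_ , aperiodic , conditions)) trivial =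
    pyramidal-quotient-aperiodic {X = X} (H (2 * i)) (λ j → H (2 * i + j)) s ε∈X 1≤s
      (series-shift series ≡.refl)
      (≡⇒⊆ᴴ {H = H} (+-identityʳ (2 * i)))
      (≡⇒⊆ᴴ {H = H} (≡.sym (+-identityʳ (2 * i))))
      (even-quotient-aperiodic series trivial aperiodic (proj₁ (proj₂ conditions)) i (m<m+n i 1≤s))
      (TConditions-shift {A = G} {X} {H} (2 * i) i s ≡.refl 1≤s conditions)
    where
    series : SubgroupSeries G H (i + s)
    series = pyramidal-series pyramidal

  odd-quotient-pyramidal : ∀ i s → 1 ≤ s → PyramidalWith G X H (suc i + s) → ¬ Trivial G (H 0) →
    PyramidalWith (G /ᴳ H (suc (2 * i))) (X /ˢ H (suc (2 * i))) (λ j → H (2 + 2 * i + j) /ᴴ H (suc (2 * i))) s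
  odd-quotient-pyramidal i s 1≤s (_ , _ , _ , _ , _ , inj₁ (trivial , _)) nontrivial = ⊥-elim (nontrivial trivial)
  odd-quotient-pyramidal i s 1≤s pyramidal@(ε∈X , _ , _ , _ , _ , inj₂ (_ , _ , conditions)) _ =
    pyramidal-quotient-periodic {X = X} (H (suc (2 * i))) (λ j → H (2 + 2 * i + j)) s ε∈X 1≤s
      shifted
      (λ x Kx → ≡⇒⊆ᴴ {H = H} (≡.sym (+-identityʳ (2 + 2 * i))) x (K⊆H[2+2i] x Kx))
      periodic
      (TConditions-unquotient {X = X} (H 0) (λ j → H (2 + 2 * i + j)) s H₀⊆S
        (TConditions-shift {A = G /ᴳ H 0} {X /ˢ H 0} {λ j → H j /ᴴ H 0} (2 + 2 * i) (suc i) s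
                           2+2i≡2[1+i] 1≤s conditions))
    where
    series : SubgroupSeries G H (suc i + s)
    series = pyramidal-series pyramidal
    2+2i≡2[1+i] : 2 + 2 * i ≡ 2 * suc i
    2+2i≡2[1+i] = ≡.sym (*-suc 2 i)
    shifted : SubgroupSeries G (λ j → H (2 + 2 * i + j)) s
    shifted = series-shift series 2+2i≡2[1+i]
    2+2i≤2t : 2 + 2 * i ≤ 2 * (suc i + s)
    2+2i≤2t = 2+2*k≤2*s (m≤m+n (suc i) s)
    K⊆H[2+2i] : _⊆ᴴ_ G (H (suc (2 * i))) (H (2 + 2 * i))
    K⊆H[2+2i] = series-mono series (n≤1+n _) 2+2i≤2t
    H₀⊆K : _⊆ᴴ_ G (H 0) (H (suc (2 * i)))
    H₀⊆K = series-mono series z≤n (<⇒≤ 2+2i≤2t)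
    H₀⊆S : ∀ n → n ≤ 2 * s → _⊆ᴴ_ G (H 0) (H (2 + 2 * i + n))
    H₀⊆S n n≤2s x H₀x = series-mono shifted z≤n n≤2s x
                          (≡⇒⊆ᴴ {H = H} (≡.sym (+-identityʳ (2 + 2 * i))) x (K⊆H[2+2i] x (H₀⊆K x H₀x)))
    periodic : _-periodic_ (G /ᴳ H (suc (2 * i))) (X /ˢ H (suc (2 * i))) (H (2 + 2 * i + 0) /ᴴ H (suc (2 * i)))
    periodic =
      ≡.subst (λ n → _-periodic_ (G /ᴳ H (suc (2 * i))) (X /ˢ H (suc (2 * i))) (H n /ᴴ H (suc (2 * i))))
        (≡.sym (+-identityʳ (2 + 2 * i)))
        (periodic-transport
          {Y = (X /ˢ H 0) /ˢ (H (suc (2 * i)) /ᴴ H 0)} {X /ˢ H (suc (2 * i))}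
          {(H (2 + 2 * i) /ᴴ H 0) /ᴴ (H (suc (2 * i)) /ᴴ H 0)} {H (2 + 2 * i) /ᴴ H (suc (2 * i))}
          (third-≅ (H 0) (H (suc (2 * i))) H₀⊆K)
          (third-carries (H 0) (H (suc (2 * i))) H₀⊆K X)
          (third-carries (H 0) (H (suc (2 * i))) H₀⊆K (asSubset (H (2 + 2 * i))))
          (proj₁ (proj₂ conditions) i (m≤m+n (suc i) s)))

lemma2p11 : ∀ {c ℓ} (G : AbelianGroup c ℓ) (X : Subset G) (t : ℕ) (H : ℕ → Subgroup G) →
    PyramidalWith G X H t →
    -- (a)
    ((Trivial G (H 0) → Aperiodic G X →
       ∀ i → i < t →
         PyramidalWith (G /ᴳ H (2 * i)) (X /ˢ H (2 * i))
           (λ j → H (2 * i + j) /ᴴ H (2 * i)) (t ∸ i))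
    -- (b)
    × (¬ Trivial G (H 0) → _-periodic_ G X (H 0) →
       ∀ i → 2 + i ≤ t →
         PyramidalWith (G /ᴳ H (suc (2 * i))) (X /ˢ H (suc (2 * i)))
           (λ j → H (2 + 2 * i + j) /ᴴ H (suc (2 * i))) (t ∸ suc i)))
lemma2p11 G X t H pyramidal =
    -- The ignored hypotheses (aperiodicity of X, resp. H 0-periodicity) are already part of
    -- the case of admissibility that the triviality of H 0 selects.
    (λ trivial _ i i<t →
       even-quotient-pyramidal {X = X} {H} i (t ∸ i) (m<n⇒0<n∸m i<t) (split-at i (<⇒≤ i<t)) trivial)
  , (λ nontrivial _ i 1+i<t →
       odd-quotient-pyramidal {X = X} {H} i (t ∸ suc i) (m<n⇒0<n∸m 1+i<t) (split-at (suc i) (<⇒≤ 1+i<t))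
                              nontrivial)
  where
  split-at : ∀ m → m ≤ t → PyramidalWith G X H (m + (t ∸ m))
  split-at m m≤t = ≡.subst (PyramidalWith G X H) (≡.sym (m+[n∸m]≡n m≤t)) pyramidal
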